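{- Let $k,n$ be positive integers and write $m=\lfloor n/2\rfloor$. If $k-m$ divides $m$, then $\textsc{bm}(k,n,n)\le\min(k,\lceil n/2\rceil)$.
   Context: A hypergraph is identified with its finite edge set; a matching is a set of pairwise disjoint edges. A hypergraph $H$ is $k$-partite with sides $V_1,\ldots,V_k$ (a fixed partition of its vertex set) if $|e\cap V_t|=1$ for every edge $e$ and every $t$. For $f:H\to\mathbb{R}_{\ge0}$, $\deg_f(v)=\sum_{e\ni v}f(e)$; $f$ is balanced if $\deg_f$ is constant on each side. $H$ is $(b_1,\ldots,b_k)$-fractionally balanced if it is $k$-partite with sides of sizes $b_1,\ldots,b_k$ and has a nonzero balanced $f:H\to\mathbb{R}_{\ge0}$. $\textsc{bm}(b_1,\ldots,b_k)$ is the largest $m$ such that every $(b_1,\ldots,b_k)$-fractionally balanced $k$-partite hypergraph has a matching of size $m$. -}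

module Defs where

open import Data.Nat using (ℕ; zero; suc)
open import Data.Fin using (Fin; zero; suc)
open import Data.Bool using (Bool; true; false; if_then_else_)
open import Data.Product using (Σ; _×_; _,_; ∃-syntax)
open import Data.Rational using (ℚ; 0ℚ; _+_; _≤_)
open import Relation.Binary.PropositionalEquality using (_≡_; _≢_)
open import Relation.Nullary using (¬_)

Σℚ : (n : ℕ) → (Fin n → ℚ) → ℚ
Σℚ zero    g = 0ℚ
Σℚ (suc n) g = g zero + Σℚ n (λ i → g (suc i))

-- Every edge meets each side in exactly one vertex, so an edge is a triple;
-- the hypergraph (= its edge set) is a subset of the triples.
Triple : ℕ → ℕ → ℕ → Set
Triple b₁ b₂ b₃ = Fin b₁ × Fin b₂ × Fin b₃

Hypergraph3 : ℕ → ℕ → ℕ → Set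
Hypergraph3 b₁ b₂ b₃ = Triple b₁ b₂ b₃ → Bool

module _ {b₁ b₂ b₃ : ℕ} (H : Hypergraph3 b₁ b₂ b₃) (f : Triple b₁ b₂ b₃ → ℚ) where

  wt : Triple b₁ b₂ b₃ → ℚ
  wt e = if H e then f e else 0ℚ

  deg₁ : Fin b₁ → ℚ
  deg₁ a = Σℚ b₂ (λ b → Σℚ b₃ (λ c → wt (a , b , c)))

  deg₂ : Fin b₂ → ℚ
  deg₂ b = Σℚ b₁ (λ a → Σℚ b₃ (λ c → wt (a , b , c)))

  deg₃ : Fin b₃ → ℚ
  deg₃ c = Σℚ b₁ (λ a → Σℚ b₂ (λ b → wt (a , b , c)))

  NonNeg : Set
  NonNeg = ∀ e → H e ≡ true → 0ℚ ≤ f e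

  NonZero : Set
  NonZero = Σ (Triple b₁ b₂ b₃) (λ e → (H e ≡ true) × (f e ≢ 0ℚ))

  Balanced : Set
  Balanced = (∀ a a' → deg₁ a ≡ deg₁ a')
           × (∀ b b' → deg₂ b ≡ deg₂ b')
           × (∀ c c' → deg₃ c ≡ deg₃ c')

FracBalanced : {b₁ b₂ b₃ : ℕ} → Hypergraph3 b₁ b₂ b₃ → Set
FracBalanced {b₁} {b₂} {b₃} H =
  Σ (Triple b₁ b₂ b₃ → ℚ) (λ f → NonNeg H f × NonZero H f × Balanced H f)

Disjoint : {b₁ b₂ b₃ : ℕ} → Triple b₁ b₂ b₃ → Triple b₁ b₂ b₃ → Set
Disjoint (a , b , c) (a' , b' , c') = (a ≢ a') × (b ≢ b') × (c ≢ c')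

-- H has a matching of size s: s edges of H that are pairwise disjoint
-- (pairwise disjointness forces them to be distinct)
HasMatching : {b₁ b₂ b₃ : ℕ} → Hypergraph3 b₁ b₂ b₃ → ℕ → Set
HasMatching {b₁} {b₂} {b₃} H s =
  Σ (Fin s → Triple b₁ b₂ b₃) (λ M →
     (∀ i → H (M i) ≡ true) × (∀ i j → i ≢ j → Disjoint (M i) (M j)))

-- bm(b₁,b₂,b₃) ≤ B : some (b₁,b₂,b₃)-fractionally balanced 3-partite
-- hypergraph has no matching of size B+1.
BmAtMost : ℕ → ℕ → ℕ → ℕ → Set
BmAtMost b₁ b₂ b₃ B =
  Σ (Hypergraph3 b₁ b₂ b₃) (λ H → FracBalanced H × ¬ HasMatching H (suc B))

-- If k ≤ ⌈n/2⌉, the complete hypergraph with the uniform weight is balanced and a matching uses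
-- distinct vertices of the first side.  Otherwise put m = ⌊n/2⌋, d = k − m, m = r d and e = n − 2m.
-- Split the first side into m low and d high vertices, and each of the other two sides into m twin
-- pairs and e apex vertices.  Block j consists of the four edges joining a twin of j on side 2 to a
-- twin of j on side 3: the two parallel ones go through the low vertex j with weight m, the two
-- crossing ones through the high vertex j mod d with weight d.  Thus every twin has degree m + d = k,
-- and every first-side vertex has degree 2m, since each high vertex serves r blocks.  Joining every
-- apex vertex on sides 2 and 3 to every first-side vertex with weight 1 keeps the weighting balanced.
-- Two disjoint edges of one block would use complementary twins on both sides, hence the same
-- first-side vertex; so a matching meets each of the m blocks and the e apex vertices at most once.
module Submission where

open import Data.Bool using (Bool; true; false; not; _xor_; if_then_else_)
open import Data.Bool.Properties using (¬-not; not-involutive)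
open import Data.Empty using (⊥-elim)
open import Data.Fin using (Fin; zero; suc; fromℕ<; _↑ˡ_; _↑ʳ_; splitAt; combine; quotient; remainder)
open import Data.Fin.Properties
  using (_≟_; suc-injective; ↑ˡ-injective; ↑ʳ-injective; pigeonhole; <⇒≢;
         splitAt-↑ˡ; splitAt-↑ʳ; splitAt⁻¹-↑ˡ; splitAt⁻¹-↑ʳ; remQuot-combine)
open import Data.Integer using (+_; _-_; ∣_∣)
open import Data.Integer.Divisibility using (_∣_)
import Data.Integer.Properties as ℤₚ
open import Data.Nat using (ℕ; zero; suc; _+_; _*_; _∸_; _≤_; _<_; _<ᵇ_; _≤?_; _⊓_; ⌊_/2⌋; ⌈_/2⌉)
import Data.Nat as ℕ
open import Data.Nat.Divisibility using (divides) renaming (_∣_ to _∣ℕ_)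
import Data.Nat.Properties as ℕₚ
open ℕₚ using (+-assoc; *-assoc; *-identityˡ; *-identityʳ; *-zeroʳ; n<1+n)
open import Data.Nat.Tactic.RingSolver using (solve-∀)
open import Data.Product using (∃; _,_; proj₁; proj₂)
open import Data.Rational using (ℚ; 0ℚ; 1ℚ)
import Data.Rational as ℚ
import Data.Rational.Properties as ℚₚ
open import Data.Sum using (_⊎_; inj₁; inj₂; [_,_]′)
open import Function using (_∘_; id)
open import Function.Definitions using (Injective)
open import Relation.Binary.PropositionalEquality
open import Relation.Nullary using (¬_; yes; no; does)
open import Relation.Nullary.Decidable using (dec-true; dec-false)

open import Algebra.Properties.Monoid.Mult ℚₚ.+-0-monoid using (_×_; ×-homo-+)
open import Algebra.Properties.Semiring.Sum ℕₚ.+-*-semiring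
  using (sum; sum-syntax; sum-cong-≗; sum-replicate-zero; ∑-comm; ∑-distrib-+; *-distribˡ-sum; *-distribʳ-sum)

open import Defs

-- Kronecker delta and sums over Fin

δ : ∀ {n} → Fin n → Fin n → ℕ
δ i j = if does (i ≟ j) then 1 else 0

δ-refl : ∀ {n} (i : Fin n) → δ i i ≡ 1
δ-refl i rewrite dec-true (i ≟ i) refl = refl

δ-≢ : ∀ {n} {i j : Fin n} → i ≢ j → δ i j ≡ 0
δ-≢ {i = i} {j} i≢j rewrite dec-false (i ≟ j) i≢j = refl

δ≢0⇒≡ : ∀ {n} {i j : Fin n} → δ i j ≢ 0 → i ≡ j
δ≢0⇒≡ {i = i} {j} δ≢0 with i ≟ j
... | yes i≡j = i≡j
... | no _ = ⊥-elim (δ≢0 refl)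

δ-injective : ∀ {m n} {ι : Fin m → Fin n} → Injective _≡_ _≡_ ι → ∀ i j → δ (ι i) (ι j) ≡ δ i j
δ-injective {ι = ι} inj i j with i ≟ j
... | yes refl = δ-refl (ι i)
... | no i≢j = δ-≢ (i≢j ∘ inj)

∑-≡0 : ∀ {n} {g : Fin n → ℕ} → (∀ i → g i ≡ 0) → sum g ≡ 0
∑-≡0 {n} g≡0 = trans (sum-cong-≗ g≡0) (sum-replicate-zero n)

∑-1 : ∀ n → ∑[ i < n ] 1 ≡ n
∑-1 zero = refl
∑-1 (suc n) = cong suc (∑-1 n)

∑-δʳ : ∀ {n} (i : Fin n) → ∑[ j < n ] δ i j ≡ 1
∑-δʳ {suc n} zero = cong suc (sum-replicate-zero n)
∑-δʳ {suc n} (suc i) = ∑-δʳ i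

∑-δˡ : ∀ {n} (i : Fin n) → ∑[ j < n ] δ j i ≡ 1
∑-δˡ {suc n} zero = cong suc (sum-replicate-zero n)
∑-δˡ {suc n} (suc i) = ∑-δˡ i

∑-δ-injective : ∀ {m n} {ι : Fin m → Fin n} → Injective _≡_ _≡_ ι → ∀ i → ∑[ j < m ] δ (ι j) (ι i) ≡ 1
∑-δ-injective inj i = trans (sum-cong-≗ (λ j → δ-injective inj j i)) (∑-δˡ i)

∑-δ-∉ : ∀ {m n} {ι : Fin m → Fin n} {v} → (∀ j → ι j ≢ v) → ∑[ j < m ] δ (ι j) v ≡ 0
∑-δ-∉ v∉ι = ∑-≡0 (λ j → δ-≢ (v∉ι j))

∑-≢0 : ∀ {n} (g : Fin n → ℕ) → sum g ≢ 0 → ∃ λ i → g i ≢ 0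
∑-≢0 {zero} g ∑≢0 = ⊥-elim (∑≢0 refl)
∑-≢0 {suc n} g ∑≢0 with g zero ℕ.≟ 0
... | no g₀≢0 = zero , g₀≢0
... | yes g₀≡0 =
  let i , gᵢ≢0 = ∑-≢0 (g ∘ suc) (λ ∑≡0 → ∑≢0 (cong₂ _+_ g₀≡0 ∑≡0)) in suc i , gᵢ≢0

∑-↑ : ∀ m {n} (f : Fin (m + n) → ℕ) → sum f ≡ ∑[ i < m ] f (i ↑ˡ n) + ∑[ j < n ] f (m ↑ʳ j)
∑-↑ zero f = refl
∑-↑ (suc m) f = trans (cong (λ s → f zero + s) (∑-↑ m (f ∘ suc))) (sym (+-assoc (f zero) _ _))

∑-combine : ∀ n {k} (f : Fin (n * k) → ℕ) → sum f ≡ ∑[ i < n ] ∑[ t < k ] f (combine i t)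
∑-combine zero f = refl
∑-combine (suc n) {k} f = trans (∑-↑ k f) (cong (λ s → ∑[ t < k ] f (t ↑ˡ n * k) + s) (∑-combine n (f ∘ (k ↑ʳ_))))

∑-δ-quotient : ∀ n k (i : Fin n) → ∑[ j < n * k ] δ (quotient k j) i ≡ k
∑-δ-quotient n k i = begin
  ∑[ j < n * k ] δ (quotient k j) i                  ≡⟨ ∑-combine n _ ⟩
  ∑[ i′ < n ] ∑[ t < k ] δ (quotient k (combine i′ t)) i
    ≡⟨ sum-cong-≗ {n} (λ i′ → sum-cong-≗ {k} (λ t → cong (λ q → δ (proj₁ q) i) (remQuot-combine i′ t))) ⟩
  ∑[ i′ < n ] ∑[ t < k ] δ i′ i                      ≡⟨ ∑-comm {n} {k} (λ i′ t → δ i′ i) ⟩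
  ∑[ t < k ] ∑[ i′ < n ] δ i′ i                      ≡⟨ sum-cong-≗ {k} (λ _ → ∑-δˡ i) ⟩
  ∑[ t < k ] 1                                       ≡⟨ ∑-1 k ⟩
  k                                                  ∎
  where open ≡-Reasoning

∑-δ-remainder : ∀ n k (t : Fin k) → ∑[ j < n * k ] δ (remainder {n} k j) t ≡ n
∑-δ-remainder n k t = begin
  ∑[ j < n * k ] δ (remainder {n} k j) t             ≡⟨ ∑-combine n _ ⟩
  ∑[ i < n ] ∑[ t′ < k ] δ (remainder {n} k (combine i t′)) t
    ≡⟨ sum-cong-≗ {n} (λ i → sum-cong-≗ {k} (λ t′ → cong (λ q → δ (proj₂ q) t) (remQuot-combine i t′))) ⟩
  ∑[ i < n ] ∑[ t′ < k ] δ t′ t                      ≡⟨ sum-cong-≗ {n} (λ _ → ∑-δˡ t) ⟩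
  ∑[ i < n ] 1                                       ≡⟨ ∑-1 n ⟩
  n                                                  ∎
  where open ≡-Reasoning

↑ˡ≢↑ʳ : ∀ {m n} (i : Fin m) (j : Fin n) → i ↑ˡ n ≢ m ↑ʳ j
↑ˡ≢↑ʳ {suc m} zero j ()
↑ˡ≢↑ʳ {suc m} (suc i) j eq = ↑ˡ≢↑ʳ i j (suc-injective eq)

↑-cases : ∀ {m n} (P : Fin (m + n) → Set) →
          (∀ i → P (i ↑ˡ n)) → (∀ j → P (m ↑ʳ j)) → ∀ v → P v
↑-cases {m} P left right v with splitAt m v in eq
... | inj₁ i = subst P (splitAt⁻¹-↑ˡ eq) (left i)
... | inj₂ j = subst P (splitAt⁻¹-↑ʳ eq) (right j)

-- Weighted 3-partite hypergraphs

toℚ : ℕ → ℚ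
toℚ n = n × 1ℚ

toℚ-nonneg : ∀ n → 0ℚ ℚ.≤ toℚ n
toℚ-nonneg zero = ℚₚ.≤-refl
toℚ-nonneg (suc n) = ℚₚ.+-mono-≤ (ℚₚ.<⇒≤ (ℚₚ.positive⁻¹ 1ℚ)) (toℚ-nonneg n)

toℚ-≢0 : ∀ n → n ≢ 0 → toℚ n ≢ 0ℚ
toℚ-≢0 zero n≢0 = ⊥-elim (n≢0 refl)
toℚ-≢0 (suc n) _ = ≢-sym (ℚₚ.<⇒≢ (ℚₚ.+-mono-<-≤ (ℚₚ.positive⁻¹ 1ℚ) (toℚ-nonneg n)))

Σℚ-cong : ∀ n {f g : Fin n → ℚ} → (∀ i → f i ≡ g i) → Σℚ n f ≡ Σℚ n g
Σℚ-cong zero f≗g = refl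
Σℚ-cong (suc n) f≗g = cong₂ ℚ._+_ (f≗g zero) (Σℚ-cong n (f≗g ∘ suc))

Σℚ-toℚ : ∀ n (g : Fin n → ℕ) → Σℚ n (toℚ ∘ g) ≡ toℚ (sum g)
Σℚ-toℚ zero g = refl
Σℚ-toℚ (suc n) g = trans (cong (toℚ (g zero) ℚ.+_) (Σℚ-toℚ n (g ∘ suc))) (sym (×-homo-+ 1ℚ (g zero) _))

≢0-*ˡ : ∀ x {y} → x * y ≢ 0 → x ≢ 0
≢0-*ˡ x xy≢0 x≡0 = xy≢0 (cong (_* _) x≡0)

≢0-*ʳ : ∀ x {y} → x * y ≢ 0 → y ≢ 0
≢0-*ʳ x xy≢0 y≡0 = xy≢0 (trans (cong (x *_) y≡0) (*-zeroʳ x))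

∑-*δ : ∀ {n} x (i : Fin n) → ∑[ j < n ] (x * δ i j) ≡ x
∑-*δ x i = trans (sym (*-distribˡ-sum x (δ i))) (trans (cong (x *_) (∑-δʳ i)) (*-identityʳ x))

∑-δ* : ∀ {n} x (i : Fin n) → ∑[ j < n ] (δ i j * x) ≡ x
∑-δ* x i = trans (sym (*-distribʳ-sum x (δ i))) (trans (cong (_* x) (∑-δʳ i)) (*-identityˡ x))

∑∑-+ : ∀ {p q} (f g : Fin p → Fin q → ℕ) →
       ∑[ x < p ] ∑[ y < q ] (f x y + g x y) ≡ ∑[ x < p ] ∑[ y < q ] f x y + ∑[ x < p ] ∑[ y < q ] g x y
∑∑-+ {q = q} f g =
  trans (sum-cong-≗ (λ x → ∑-distrib-+ (f x) (g x))) (∑-distrib-+ (λ x → ∑[ y < q ] f x y) (λ x → ∑[ y < q ] g x y))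

∑∑-* : ∀ {p q} c (f : Fin p → Fin q → ℕ) → ∑[ x < p ] ∑[ y < q ] (c * f x y) ≡ c * ∑[ x < p ] ∑[ y < q ] f x y
∑∑-* {q = q} c f = trans (sum-cong-≗ (λ x → sym (*-distribˡ-sum c (f x)))) (sym (*-distribˡ-sum c (λ x → ∑[ y < q ] f x y)))

module _ {b₁ b₂ b₃ : ℕ} where

  degree₁ : (Triple b₁ b₂ b₃ → ℕ) → Fin b₁ → ℕ
  degree₁ W a = ∑[ b < b₂ ] ∑[ c < b₃ ] W (a , b , c)

  degree₂ : (Triple b₁ b₂ b₃ → ℕ) → Fin b₂ → ℕ
  degree₂ W b = ∑[ a < b₁ ] ∑[ c < b₃ ] W (a , b , c)

  degree₃ : (Triple b₁ b₂ b₃ → ℕ) → Fin b₃ → ℕ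
  degree₃ W c = ∑[ a < b₁ ] ∑[ b < b₂ ] W (a , b , c)

  support : (Triple b₁ b₂ b₃ → ℕ) → Hypergraph3 b₁ b₂ b₃
  support W t = 0 <ᵇ W t

  support-≢0 : ∀ {W : Triple b₁ b₂ b₃ → ℕ} {t} → support W t ≡ true → W t ≢ 0
  support-≢0 {W} {t} t∈W with W t
  ... | suc _ = λ ()

  wt-support : ∀ (W : Triple b₁ b₂ b₃ → ℕ) t → wt (support W) (toℚ ∘ W) t ≡ toℚ (W t)
  wt-support W t with W t
  ... | zero = refl
  ... | suc _ = refl

  Σℚ²-support : ∀ (W : Triple b₁ b₂ b₃ → ℕ) {p q} (ι : Fin p → Fin q → Triple b₁ b₂ b₃) →
    Σℚ p (λ x → Σℚ q (λ y → wt (support W) (toℚ ∘ W) (ι x y))) ≡ toℚ (∑[ x < p ] ∑[ y < q ] W (ι x y))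
  Σℚ²-support W {p} {q} ι = trans
    (Σℚ-cong p (λ x → trans (Σℚ-cong q (λ y → wt-support W (ι x y))) (Σℚ-toℚ q (λ y → W (ι x y)))))
    (Σℚ-toℚ p _)

  support-fracBalanced : ∀ (W : Triple b₁ b₂ b₃ → ℕ) {D₁ D₂ D₃} →
    (∀ a → degree₁ W a ≡ D₁) → (∀ b → degree₂ W b ≡ D₂) → (∀ c → degree₃ W c ≡ D₃) →
    (∃ λ t → W t ≢ 0) → FracBalanced (support W)
  support-fracBalanced W deg₁≡ deg₂≡ deg₃≡ (t , Wt≢0) =
    toℚ ∘ W , (λ t _ → toℚ-nonneg (W t)) , (t , ≢0⇒support , toℚ-≢0 (W t) Wt≢0) ,
    ( equalise (λ a → Σℚ²-support W (λ b c → a , b , c)) deg₁≡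
    , equalise (λ b → Σℚ²-support W (λ a c → a , b , c)) deg₂≡
    , equalise (λ c → Σℚ²-support W (λ a b → a , b , c)) deg₃≡ )
    where
    ≢0⇒support : support W t ≡ true
    ≢0⇒support with W t
    ... | zero = ⊥-elim (Wt≢0 refl)
    ... | suc _ = refl

    equalise : ∀ {V : Set} {F : V → ℚ} {G : V → ℕ} {D} →
               (∀ v → F v ≡ toℚ (G v)) → (∀ v → G v ≡ D) → ∀ v v′ → F v ≡ F v′
    equalise F≡ G≡ v v′ = trans (F≡ v) (trans (cong toℚ (trans (G≡ v) (sym (G≡ v′)))) (sym (F≡ v′)))

  degree₂-≢0 : ∀ (W : Triple b₁ b₂ b₃ → ℕ) b → degree₂ W b ≢ 0 → ∃ λ t → W t ≢ 0
  degree₂-≢0 W b deg≢0 =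
    let a , ∑≢0 = ∑-≢0 _ deg≢0
        c , Wt≢0 = ∑-≢0 _ ∑≢0
    in (a , b , c) , Wt≢0

  δ₃ : Triple b₁ b₂ b₃ → Triple b₁ b₂ b₃ → ℕ
  δ₃ (a , b , c) (a′ , b′ , c′) = δ a a′ * (δ b b′ * δ c c′)

  δ₃≢0⇒≡ : ∀ s t → δ₃ s t ≢ 0 → s ≡ t
  δ₃≢0⇒≡ (a , b , c) (a′ , b′ , c′) δ₃≢0 =
    cong₂ _,_ (δ≢0⇒≡ (≢0-*ˡ (δ a a′) δ₃≢0))
              (cong₂ _,_ (δ≢0⇒≡ (≢0-*ˡ (δ b b′) δbc≢0)) (δ≢0⇒≡ (≢0-*ʳ (δ b b′) δbc≢0)))
    where δbc≢0 = ≢0-*ʳ (δ a a′) δ₃≢0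

  multiplicity : ∀ {N} → (Fin N → Triple b₁ b₂ b₃) → Triple b₁ b₂ b₃ → ℕ
  multiplicity {N} E t = ∑[ j < N ] δ₃ (E j) t

  multiplicity-≢0 : ∀ {N} (E : Fin N → Triple b₁ b₂ b₃) t → multiplicity E t ≢ 0 → ∃ λ j → E j ≡ t
  multiplicity-≢0 E t multiplicity≢0 = let j , δ₃≢0 = ∑-≢0 _ multiplicity≢0 in j , δ₃≢0⇒≡ (E j) t δ₃≢0

  ∑∑-multiplicity : ∀ {N p q} (E : Fin N → Triple b₁ b₂ b₃) (ι : Fin p → Fin q → Triple b₁ b₂ b₃) →
    ∑[ x < p ] ∑[ y < q ] multiplicity E (ι x y) ≡ ∑[ j < N ] ∑[ x < p ] ∑[ y < q ] δ₃ (E j) (ι x y)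
  ∑∑-multiplicity {N} {p} {q} E ι = trans (sum-cong-≗ {p} (λ x → ∑-comm {q} {N} _)) (∑-comm {p} {N} _)

  degree₁-multiplicity : ∀ {N} (E : Fin N → Triple b₁ b₂ b₃) a → degree₁ (multiplicity E) a ≡ ∑[ j < N ] δ (proj₁ (E j)) a
  degree₁-multiplicity E a = trans (∑∑-multiplicity E (λ b c → a , b , c)) (sum-cong-≗ (λ j → collapse (E j)))
    where
    collapse : ∀ e → ∑[ b < b₂ ] ∑[ c < b₃ ] δ₃ e (a , b , c) ≡ δ (proj₁ e) a
    collapse (x , y , z) = trans
      (sum-cong-≗ (λ b → trans (sum-cong-≗ (λ c → sym (*-assoc (δ x a) (δ y b) (δ z c)))) (∑-*δ _ z)))
      (∑-*δ _ y)

  degree₂-multiplicity : ∀ {N} (E : Fin N → Triple b₁ b₂ b₃) b → degree₂ (multiplicity E) b ≡ ∑[ j < N ] δ (proj₁ (proj₂ (E j))) b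
  degree₂-multiplicity E b = trans (∑∑-multiplicity E (λ a c → a , b , c)) (sum-cong-≗ (λ j → collapse (E j)))
    where
    collapse : ∀ e → ∑[ a < b₁ ] ∑[ c < b₃ ] δ₃ e (a , b , c) ≡ δ (proj₁ (proj₂ e)) b
    collapse (x , y , z) = trans
      (sum-cong-≗ (λ a → trans (sum-cong-≗ (λ c → sym (*-assoc (δ x a) (δ y b) (δ z c)))) (∑-*δ _ z)))
      (∑-δ* _ x)

  degree₃-multiplicity : ∀ {N} (E : Fin N → Triple b₁ b₂ b₃) c → degree₃ (multiplicity E) c ≡ ∑[ j < N ] δ (proj₂ (proj₂ (E j))) c
  degree₃-multiplicity E c = trans (∑∑-multiplicity E (λ a b → a , b , c)) (sum-cong-≗ (λ j → collapse (E j)))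
    where
    collapse : ∀ e → ∑[ a < b₁ ] ∑[ b < b₂ ] δ₃ e (a , b , c) ≡ δ (proj₂ (proj₂ e)) c
    collapse (x , y , z) = trans
      (sum-cong-≗ (λ a → trans (sym (*-distribˡ-sum (δ x a) (λ b → δ y b * δ z c))) (cong (δ x a *_) (∑-δ* _ y))))
      (∑-δ* _ x)

intersecting-classes⇒¬HasMatching : ∀ {b₁ b₂ b₃ B} (H : Hypergraph3 b₁ b₂ b₃) (class : Triple b₁ b₂ b₃ → Fin B) →
  (∀ {t t′} → H t ≡ true → H t′ ≡ true → class t ≡ class t′ → ¬ Disjoint t t′) →
  ¬ HasMatching H (suc B)
intersecting-classes⇒¬HasMatching {B = B} H class intersecting (M , M⊆H , disjoint)
  with pigeonhole (n<1+n B) (class ∘ M)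
... | i , j , i<j , same-class = intersecting (M⊆H i) (M⊆H j) same-class (disjoint i j (<⇒≢ i<j))

complete-bmAtMost : ∀ {b₁ b₂ b₃} → 0 < b₁ → 0 < b₂ → 0 < b₃ → BmAtMost b₁ b₂ b₃ b₁
complete-bmAtMost 0<b₁ 0<b₂ 0<b₃ =
  support uniform ,
  support-fracBalanced uniform (λ _ → refl) (λ _ → refl) (λ _ → refl)
    ((fromℕ< 0<b₁ , fromℕ< 0<b₂ , fromℕ< 0<b₃) , λ ()) ,
  intersecting-classes⇒¬HasMatching _ proj₁ (λ _ _ same (a≢a′ , _) → a≢a′ same)
  where
  uniform = λ _ → 1

xor-complements : ∀ {β β′ γ γ′} → β ≢ β′ → γ ≢ γ′ → β xor γ ≡ β′ xor γ′
xor-complements {β′ = β′} {γ′ = γ′} β≢β′ γ≢γ′ rewrite ¬-not β≢β′ | ¬-not γ≢γ′ = not-xor-not β′ γ′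
  where
  not-xor-not : ∀ x y → not x xor not y ≡ x xor y
  not-xor-not false y = not-involutive y
  not-xor-not true y = refl

+-≢0 : ∀ {x y} → x + y ≢ 0 → x ≢ 0 ⊎ y ≢ 0
+-≢0 {zero} y≢0 = inj₂ y≢0
+-≢0 {suc x} _ = inj₁ (λ ())

-- The construction for ⌊n/2⌋ < k

module Construction (r d e : ℕ) where

  open ≡-Reasoning

  m k n : ℕ
  m = r * d
  k = m + d
  n = (m + m) + e

  low : Fin m → Fin k
  low j = j ↑ˡ d

  high : Fin d → Fin k
  high t = m ↑ʳ t

  column : Fin m → Fin d
  column = remainder {r} d

  hub : Fin m → Bool → Fin k
  hub j false = low j
  hub j true = high (column j)

  twin : Fin m → Bool → Fin n
  twin j false = (j ↑ˡ m) ↑ˡ e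
  twin j true = (m ↑ʳ j) ↑ˡ e

  apex : Fin e → Fin n
  apex i = (m + m) ↑ʳ i

  blockEdge : Bool → Bool → Fin m → Triple k n n
  blockEdge β γ j = hub j (β xor γ) , twin j β , twin j γ

  -- indexed by the pairs in Fin k × Fin e, flattened by remQuot
  apexEdge : Fin (k * e) → Triple k n n
  apexEdge j = quotient e j , apex (remainder {k} e j) , apex (remainder {k} e j)

  weight : Triple k n n → ℕ
  weight t = m * multiplicity (blockEdge false false) t + m * multiplicity (blockEdge true true) t
           + d * multiplicity (blockEdge false true) t + d * multiplicity (blockEdge true false) t
           + multiplicity apexEdge t

  ∑∑-weight : ∀ {p q} (ι : Fin p → Fin q → Triple k n n) (C : ∀ {N} → (Fin N → Triple k n n) → ℕ) →
    (∀ {N} (E : Fin N → Triple k n n) → ∑[ x < p ] ∑[ y < q ] multiplicity E (ι x y) ≡ C E) →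
    ∑[ x < p ] ∑[ y < q ] weight (ι x y)
      ≡ m * C (blockEdge false false) + m * C (blockEdge true true)
      + d * C (blockEdge false true) + d * C (blockEdge true false) + C apexEdge
  ∑∑-weight {p} {q} ι C ∑∑-multiplicity≡ =
    trans (∑∑-+ {p} {q} _ _) (cong₂ _+_
      (trans (∑∑-+ {p} {q} _ _) (cong₂ _+_
        (trans (∑∑-+ {p} {q} _ _) (cong₂ _+_
          (trans (∑∑-+ {p} {q} _ _) (cong₂ _+_ (scaled m _) (scaled m _)))
          (scaled d _)))
        (scaled d _)))
      (∑∑-multiplicity≡ apexEdge))
    where
    scaled : ∀ c {N} (E : Fin N → Triple k n n) →
             ∑[ x < p ] ∑[ y < q ] (c * multiplicity E (ι x y)) ≡ c * C E
    scaled c E = trans (∑∑-* c (λ x y → multiplicity E (ι x y))) (cong (c *_) (∑∑-multiplicity≡ E))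

  lowCount highCount blockDegree : Fin k → ℕ
  lowCount a = ∑[ j < m ] δ (low j) a
  highCount a = ∑[ j < m ] δ (high (column j)) a
  blockDegree a = m * lowCount a + m * lowCount a + d * highCount a + d * highCount a

  blockDegree≡ : ∀ a → blockDegree a ≡ m + m
  blockDegree≡ = ↑-cases (λ a → blockDegree a ≡ m + m) atLow atHigh
    where
    atLow : ∀ j₀ → blockDegree (low j₀) ≡ m + m
    atLow j₀ = begin
      blockDegree (low j₀)
        ≡⟨ cong₂ (λ L R → m * L + m * L + d * R + d * R)
                 (∑-δ-injective (λ {i} {j} → ↑ˡ-injective d i j) j₀)
                 (∑-δ-∉ (λ j eq → ↑ˡ≢↑ʳ j₀ (column j) (sym eq))) ⟩
      m * 1 + m * 1 + d * 0 + d * 0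
        ≡⟨ arith m d ⟩
      m + m ∎
      where
      arith : ∀ x y → x * 1 + x * 1 + y * 0 + y * 0 ≡ x + x
      arith = solve-∀
    atHigh : ∀ t₀ → blockDegree (high t₀) ≡ m + m
    atHigh t₀ = begin
      blockDegree (high t₀)
        ≡⟨ cong₂ (λ L R → m * L + m * L + d * R + d * R)
                 (∑-δ-∉ {ι = low} (λ j → ↑ˡ≢↑ʳ j t₀))
                 (trans (sum-cong-≗ (λ j → δ-injective (λ {i} {j} → ↑ʳ-injective m i j) (column j) t₀))
                        (∑-δ-remainder r d t₀)) ⟩
      m * 0 + m * 0 + d * r + d * r
        ≡⟨ arith r d ⟩
      m + m ∎
      where
      arith : ∀ x y → x * y * 0 + x * y * 0 + y * x + y * x ≡ x * y + x * y
      arith = solve-∀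

  degree₁-weight : ∀ a → degree₁ weight a ≡ (m + m) + e
  degree₁-weight a = begin
    degree₁ weight a
      ≡⟨ ∑∑-weight (λ b c → a , b , c) (λ E → ∑[ j < _ ] δ (proj₁ (E j)) a) (λ E → degree₁-multiplicity E a) ⟩
    blockDegree a + ∑[ j < k * e ] δ (quotient e j) a
      ≡⟨ cong₂ _+_ (blockDegree≡ a) (∑-δ-quotient k e a) ⟩
    (m + m) + e ∎

  twinCount : Bool → Fin n → ℕ
  twinCount β v = ∑[ j < m ] δ (twin j β) v

  innerCount apexCount : Fin n → ℕ
  innerCount v = ∑[ u < m + m ] δ (u ↑ˡ e) v
  apexCount v = ∑[ j < k * e ] δ (apex (remainder {k} e j)) v

  twinCount≡innerCount : ∀ v → twinCount false v + twinCount true v ≡ innerCount v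
  twinCount≡innerCount v = sym (∑-↑ m (λ u → δ (u ↑ˡ e) v))

  sideDegree≡ : ∀ v → k * innerCount v + apexCount v ≡ k
  sideDegree≡ = ↑-cases (λ v → k * innerCount v + apexCount v ≡ k) atInner atApex
    where
    atInner : ∀ u₀ → k * innerCount (u₀ ↑ˡ e) + apexCount (u₀ ↑ˡ e) ≡ k
    atInner u₀ = begin
      k * innerCount (u₀ ↑ˡ e) + apexCount (u₀ ↑ˡ e)
        ≡⟨ cong₂ (λ I X → k * I + X)
                 (∑-δ-injective (λ {i} {j} → ↑ˡ-injective e i j) u₀)
                 (∑-δ-∉ (λ j eq → ↑ˡ≢↑ʳ u₀ (remainder {k} e j) (sym eq))) ⟩
      k * 1 + 0
        ≡⟨ cong (_+ 0) (*-identityʳ k) ⟩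
      k + 0
        ≡⟨ ℕₚ.+-identityʳ k ⟩
      k ∎
    atApex : ∀ i₀ → k * innerCount (apex i₀) + apexCount (apex i₀) ≡ k
    atApex i₀ = begin
      k * innerCount (apex i₀) + apexCount (apex i₀)
        ≡⟨ cong₂ (λ I X → k * I + X)
                 (∑-δ-∉ {m + m} {ι = _↑ˡ e} (λ u → ↑ˡ≢↑ʳ u i₀))
                 (trans (sum-cong-≗ (λ j → δ-injective (λ {i} {j} → ↑ʳ-injective (m + m) i j) (remainder {k} e j) i₀))
                        (∑-δ-remainder k e i₀)) ⟩
      k * 0 + k
        ≡⟨ cong (_+ k) (*-zeroʳ k) ⟩
      k ∎

  degree₂-weight : ∀ b → degree₂ weight b ≡ k
  degree₂-weight b = begin
    degree₂ weight b
      ≡⟨ ∑∑-weight (λ a c → a , b , c) (λ E → ∑[ j < _ ] δ (proj₁ (proj₂ (E j))) b) (λ E → degree₂-multiplicity E b) ⟩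
    m * T₀ + m * T₁ + d * T₀ + d * T₁ + apexCount b
      ≡⟨ arith m d T₀ T₁ (apexCount b) ⟩
    k * (T₀ + T₁) + apexCount b
      ≡⟨ cong (λ T → k * T + apexCount b) (twinCount≡innerCount b) ⟩
    k * innerCount b + apexCount b
      ≡⟨ sideDegree≡ b ⟩
    k ∎
    where
    T₀ = twinCount false b
    T₁ = twinCount true b
    arith : ∀ x y s t u → x * s + x * t + y * s + y * t + u ≡ (x + y) * (s + t) + u
    arith = solve-∀

  degree₃-weight : ∀ c → degree₃ weight c ≡ k
  degree₃-weight c = begin
    degree₃ weight c
      ≡⟨ ∑∑-weight (λ a b → a , b , c) (λ E → ∑[ j < _ ] δ (proj₂ (proj₂ (E j))) c) (λ E → degree₃-multiplicity E c) ⟩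
    m * T₀ + m * T₁ + d * T₁ + d * T₀ + apexCount c
      ≡⟨ arith m d T₀ T₁ (apexCount c) ⟩
    k * (T₀ + T₁) + apexCount c
      ≡⟨ cong (λ T → k * T + apexCount c) (twinCount≡innerCount c) ⟩
    k * innerCount c + apexCount c
      ≡⟨ sideDegree≡ c ⟩
    k ∎
    where
    T₀ = twinCount false c
    T₁ = twinCount true c
    arith : ∀ x y s t u → x * s + x * t + y * t + y * s + u ≡ (x + y) * (s + t) + u
    arith = solve-∀

  block : Fin n → Fin (m + e)
  block v = [ (λ u → [ id , id ]′ (splitAt m u) ↑ˡ e) , m ↑ʳ_ ]′ (splitAt (m + m) v)

  block-twin : ∀ j β → block (twin j β) ≡ j ↑ˡ e
  block-twin j false rewrite splitAt-↑ˡ (m + m) (j ↑ˡ m) e | splitAt-↑ˡ m j m = refl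
  block-twin j true rewrite splitAt-↑ˡ (m + m) (m ↑ʳ j) e | splitAt-↑ʳ m m j = refl

  block-apex : ∀ i → block (apex i) ≡ m ↑ʳ i
  block-apex i rewrite splitAt-↑ʳ (m + m) e i = refl

  data Edge : Triple k n n → Set where
    block-edge : ∀ β γ j → Edge (blockEdge β γ j)
    apex-edge : ∀ j → Edge (apexEdge j)

  multiplicity≢0⇒Edge : ∀ {N} {E : Fin N → Triple k n n} →
                        (∀ j → Edge (E j)) → ∀ t → multiplicity E t ≢ 0 → Edge t
  multiplicity≢0⇒Edge {E = E} edge t multiplicity≢0 =
    let j , Ej≡t = multiplicity-≢0 E t multiplicity≢0 in subst Edge Ej≡t (edge j)

  weight≢0⇒Edge : ∀ t → weight t ≢ 0 → Edge t
  weight≢0⇒Edge t weight≢0 with +-≢0 weight≢0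
  ... | inj₂ apex≢0 = multiplicity≢0⇒Edge apex-edge t apex≢0
  ... | inj₁ w₄≢0 with +-≢0 w₄≢0
  ... | inj₂ tf≢0 = multiplicity≢0⇒Edge (block-edge true false) t (≢0-*ʳ d tf≢0)
  ... | inj₁ w₃≢0 with +-≢0 w₃≢0
  ... | inj₂ ft≢0 = multiplicity≢0⇒Edge (block-edge false true) t (≢0-*ʳ d ft≢0)
  ... | inj₁ w₂≢0 with +-≢0 w₂≢0
  ... | inj₁ ff≢0 = multiplicity≢0⇒Edge (block-edge false false) t (≢0-*ʳ m ff≢0)
  ... | inj₂ tt≢0 = multiplicity≢0⇒Edge (block-edge true true) t (≢0-*ʳ m tt≢0)

  class : Triple k n n → Fin (m + e)
  class (_ , b , _) = block b

  edges-intersect : ∀ {t t′} → Edge t → Edge t′ → class t ≡ class t′ → ¬ Disjoint t t′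
  edges-intersect (block-edge β γ j) (block-edge β′ γ′ j′) same (a≢a′ , b≢b′ , c≢c′)
    with ↑ˡ-injective e j j′ (trans (sym (block-twin j β)) (trans same (block-twin j′ β′)))
  ... | refl = a≢a′ (cong (hub j) (xor-complements {β} {β′} {γ} {γ′} (b≢b′ ∘ cong (twin j)) (c≢c′ ∘ cong (twin j))))
  edges-intersect (block-edge β γ j) (apex-edge j′) same _ =
    ↑ˡ≢↑ʳ j _ (trans (sym (block-twin j β)) (trans same (block-apex _)))
  edges-intersect (apex-edge j) (block-edge β′ γ′ j′) same _ =
    ↑ˡ≢↑ʳ j′ _ (trans (sym (block-twin j′ β′)) (trans (sym same) (block-apex _)))
  edges-intersect (apex-edge j) (apex-edge j′) same (_ , b≢b′ , _) =
    b≢b′ (cong apex (↑ʳ-injective m _ _ (trans (sym (block-apex _)) (trans same (block-apex _)))))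

  bmAtMost : 0 < d → 0 < n → BmAtMost k n n (m + e)
  bmAtMost 0<d 0<n =
    support weight ,
    support-fracBalanced weight degree₁-weight degree₂-weight degree₃-weight
      (degree₂-≢0 weight (fromℕ< 0<n) (λ deg≡0 → k≢0 (trans (sym (degree₂-weight (fromℕ< 0<n))) deg≡0))) ,
    intersecting-classes⇒¬HasMatching _ class
      (λ {t} {t′} t∈ t′∈ → edges-intersect (edge t∈) (edge t′∈))
    where
    edge : ∀ {t} → support weight t ≡ true → Edge t
    edge {t} t∈ = weight≢0⇒Edge t (support-≢0 {W = weight} t∈)

    k≢0 : k ≢ 0
    k≢0 k≡0 = ℕₚ.<⇒≢ 0<d (sym (ℕₚ.m+n≡0⇒n≡0 m k≡0))

bmAtMost-⌈n/2⌉ : ∀ k n → 0 < n → ⌊ n /2⌋ < k → (k ∸ ⌊ n /2⌋) ∣ℕ ⌊ n /2⌋ → BmAtMost k n n ⌈ n /2⌉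
bmAtMost-⌈n/2⌉ k n 0<n ⌊n/2⌋<k (divides r ⌊n/2⌋≡r*d) =
  transport k≡ n≡ ⌈n/2⌉≡ (C.bmAtMost (ℕₚ.m<n⇒0<n∸m ⌊n/2⌋<k) (subst (0 <_) (sym n≡) 0<n))
  where
  d = k ∸ ⌊ n /2⌋
  e = ⌈ n /2⌉ ∸ ⌊ n /2⌋
  module C = Construction r d e
  open ≡-Reasoning

  ⌈n/2⌉≡⌊n/2⌋+e : ⌈ n /2⌉ ≡ ⌊ n /2⌋ + e
  ⌈n/2⌉≡⌊n/2⌋+e = sym (ℕₚ.m+[n∸m]≡n (ℕₚ.⌊n/2⌋≤⌈n/2⌉ n))

  k≡ : C.k ≡ k
  k≡ = trans (cong (_+ d) (sym ⌊n/2⌋≡r*d)) (ℕₚ.m+[n∸m]≡n (ℕₚ.<⇒≤ ⌊n/2⌋<k))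

  n≡ : C.n ≡ n
  n≡ = begin
    (r * d + r * d) + e        ≡⟨ cong (λ m → (m + m) + e) ⌊n/2⌋≡r*d ⟨
    (⌊ n /2⌋ + ⌊ n /2⌋) + e    ≡⟨ +-assoc ⌊ n /2⌋ ⌊ n /2⌋ e ⟩
    ⌊ n /2⌋ + (⌊ n /2⌋ + e)    ≡⟨ cong (λ s → ⌊ n /2⌋ + s) ⌈n/2⌉≡⌊n/2⌋+e ⟨
    ⌊ n /2⌋ + ⌈ n /2⌉          ≡⟨ ℕₚ.⌊n/2⌋+⌈n/2⌉≡n n ⟩
    n                          ∎

  ⌈n/2⌉≡ : r * d + e ≡ ⌈ n /2⌉
  ⌈n/2⌉≡ = trans (cong (_+ e) (sym ⌊n/2⌋≡r*d)) (sym ⌈n/2⌉≡⌊n/2⌋+e)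

  transport : ∀ {k k′ n n′ B B′} → k ≡ k′ → n ≡ n′ → B ≡ B′ → BmAtMost k n n B → BmAtMost k′ n′ n′ B′
  transport refl refl refl bm = bm

theorem6p2 : (k n : ℕ) → 1 ≤ k → 1 ≤ n →
    ((+ k) - (+ ⌊ n /2⌋)) ∣ (+ ⌊ n /2⌋) →
    BmAtMost k n n (k ⊓ ⌈ n /2⌉)
theorem6p2 k n 1≤k 1≤n k-⌊n/2⌋∣⌊n/2⌋ with k ≤? ⌈ n /2⌉
... | yes k≤⌈n/2⌉ =
  subst (BmAtMost k n n) (sym (ℕₚ.m≤n⇒m⊓n≡m k≤⌈n/2⌉)) (complete-bmAtMost 1≤k 1≤n 1≤n)
... | no k≰⌈n/2⌉ =
  subst (BmAtMost k n n) (sym (ℕₚ.m≥n⇒m⊓n≡n (ℕₚ.<⇒≤ ⌈n/2⌉<k)))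
    (bmAtMost-⌈n/2⌉ k n 1≤n ⌊n/2⌋<k (subst (λ z → ∣ z ∣ ∣ℕ ⌊ n /2⌋) k-⌊n/2⌋≡k∸⌊n/2⌋ k-⌊n/2⌋∣⌊n/2⌋))
  where
  ⌈n/2⌉<k = ℕₚ.≰⇒> k≰⌈n/2⌉
  ⌊n/2⌋<k = ℕₚ.≤-<-trans (ℕₚ.⌊n/2⌋≤⌈n/2⌉ n) ⌈n/2⌉<k
  k-⌊n/2⌋≡k∸⌊n/2⌋ : (+ k) - (+ ⌊ n /2⌋) ≡ + (k ∸ ⌊ n /2⌋)
  k-⌊n/2⌋≡k∸⌊n/2⌋ = trans (ℤₚ.m-n≡m⊖n k ⌊ n /2⌋) (ℤₚ.⊖-≥ (ℕₚ.<⇒≤ ⌊n/2⌋<k))
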